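{- Let $\lambda$ be a nonempty partition. (1) For every integer $k\geq 2$, \[ \frac{s_\lambda(1^k)}{k}\geq \frac{s_\lambda(1^{k-1})}{k-1}. \] (2) If, in addition, $2\leq \ell(\lambda)\leq k-1$, then \[ \frac{s_\lambda(1^k)}{k}\geq \frac{s_\lambda(1^{k-1})}{k-1}+\frac{1}{k}. \]
   Context: For a partition $\lambda$, $\ell(\lambda)$ denotes its number of nonzero parts. A semistandard Young tableau of shape $\lambda$ is a filling of the Young diagram of $\lambda$ with positive integers such that rows weakly increase from left to right and columns strictly increase from top to bottom. $s_\lambda(1^m)$ denotes the Schur polynomial $s_\lambda$ evaluated at $m$ ones, i.e. the number of semistandard Young tableaux of shape $\lambda$ with entries in $\{1,\dots,m\}$ (equivalently, $\dim S_\lambda\mathbf{C}^m$). -}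

module Defs where

open import Data.Nat using (ℕ; zero; suc; _+_; _≤_; _<_)
open import Data.Nat.Properties using (_≤?_; _<?_)
open import Data.List using (List; []; _∷_; length; map; concatMap; filter; upTo)
open import Data.List.Relation.Unary.All using (All)
open import Data.List.Relation.Unary.Linked using (Linked; []; [-]; _∷_)
open import Data.Product using (_×_; _,_)
open import Data.Unit using (⊤; tt)
open import Relation.Nullary using (Dec; yes; no; _×-dec_)

IsPartition : List ℕ → Set
IsPartition λs = All (λ p → 1 ≤ p) λs × Linked (λ a b → b ≤ a) λs

ℓ : List ℕ → ℕ
ℓ = length

-- A filling of a Young diagram, given as its list of rows (top to bottom).
Filling : Set
Filling = List (List ℕ)

words : ℕ → ℕ → List (List ℕ)
words m zero    = [] ∷ []
words m (suc r) = concatMap (λ a → map (suc a ∷_) (words m r)) (upTo m)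

fillings : ℕ → List ℕ → List Filling
fillings m []       = [] ∷ []
fillings m (r ∷ λs) = concatMap (λ w → map (w ∷_) (fillings m λs)) (words m r)

RowWeak : List ℕ → Set
RowWeak = Linked _≤_

rowWeak? : (w : List ℕ) → Dec (RowWeak w)
rowWeak? []           = yes []
rowWeak? (a ∷ [])     = yes [-]
rowWeak? (a ∷ b ∷ w) with a ≤? b | rowWeak? (b ∷ w)
... | yes p | yes q = yes (p ∷ q)
... | no ¬p | _     = no λ { (p ∷ _) → ¬p p }
... | _     | no ¬q = no λ { (_ ∷ q) → ¬q q }

ColStrict : List ℕ → List ℕ → Set
ColStrict (a ∷ as) (b ∷ bs) = a < b × ColStrict as bs
ColStrict _        _        = ⊤

colStrict? : (u v : List ℕ) → Dec (ColStrict u v)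
colStrict? (a ∷ as) (b ∷ bs) = (a <? b) ×-dec colStrict? as bs
colStrict? []       _        = yes tt
colStrict? (a ∷ as) []       = yes tt

IsSSYT : Filling → Set
IsSSYT []            = ⊤
IsSSYT (u ∷ [])      = RowWeak u
IsSSYT (u ∷ v ∷ rs)  = RowWeak u × ColStrict u v × IsSSYT (v ∷ rs)

isSSYT? : (T : Filling) → Dec (IsSSYT T)
isSSYT? []           = yes tt
isSSYT? (u ∷ [])     = rowWeak? u
isSSYT? (u ∷ v ∷ rs) = rowWeak? u ×-dec (colStrict? u v ×-dec isSSYT? (v ∷ rs))

-- s_λ(1^m): the number of semistandard Young tableaux of shape λ
-- with entries in {1,…,m}.
schurOnes : List ℕ → ℕ → ℕ
schurOnes λs m = length (filter isSSYT? (fillings m λs))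

-- Write s(m) for s_λ(1^m). The sequence s is convex, 2 s(M) ≤ s(M+1) + s(M−1):
-- one copy of the M-tableaux sits inside the (M+1)-tableaux; a tableau of a
-- second copy goes to the (M−1)-tableaux if all its entries are < M, and
-- otherwise has its entries ≥ M raised by one, which lands it among the
-- (M+1)-tableaux containing M+1 but not M. Together with s(0) = 0, convexity
-- makes s(k)/k nondecreasing. When 2 ≤ ℓ(λ) ≤ M+1, the tableau whose rows are
-- constant with values M+2−ℓ, …, M, M+1 is missed by this injection, so the
-- convexity, and with it the ratio inequality, is strict.
module Submission where

open import Defs
open import Data.Nat using (ℕ; zero; suc; _+_; _*_; _≤_; _<_; _≤?_; z≤n; s≤s)
open import Data.Nat.Properties
open import Data.Nat.Tactic.RingSolver using (solve-∀)
open import Data.List using (List; []; _∷_; length; map; _++_; filter; upTo;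
  replicate; concatMap; cartesianProductWith)
open import Data.List.Properties using (length-map; length-++; length-replicate;
  ∷-injective; map-injective)
open import Data.List.Membership.Propositional using (_∈_; find)
open import Data.List.Membership.Propositional.Properties
open import Data.List.Relation.Unary.Any as Any using (Any; here; there)
import Data.List.Relation.Unary.Any.Properties as Any
open import Data.List.Relation.Unary.All as All using (All; []; _∷_; all?)
import Data.List.Relation.Unary.All.Properties as All
open import Data.List.Relation.Unary.Linked as Linked using ([]; [-]; _∷_)
import Data.List.Relation.Unary.Linked.Properties as Linked
open import Data.List.Relation.Binary.Pointwise using (Pointwise; []; _∷_)
open import Data.List.Relation.Unary.Unique.Propositional using (Unique; []; _∷_)
import Data.List.Relation.Unary.Unique.Propositional.Properties as Unique
open import Data.Product using (∃; _×_; _,_; proj₁; proj₂)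
open import Data.Sum using (_⊎_; inj₁; inj₂)
open import Data.Sum.Properties using (inj₁-injective)
open import Function using (_∘_)
open import Data.Unit using (tt)
open import Relation.Nullary using (¬_; Dec; yes; no; contradiction)
open import Relation.Binary using (tri<; tri≈; tri>)
open import Relation.Binary.PropositionalEquality

module _ {A : Set} where

  ∈-delete : ∀ {y : A} ys → y ∈ ys → ∃ λ zs →
    length ys ≡ suc (length zs) × (∀ {z} → z ∈ ys → z ≢ y → z ∈ zs)
  ∈-delete (y ∷ ys) (here refl) = ys , refl , λ where
    (here refl) z≢y → contradiction refl z≢y
    (there z∈ys) _  → z∈ys
  ∈-delete (a ∷ ys) (there y∈ys) =
    let zs , len , keep = ∈-delete ys y∈ys in
    a ∷ zs , cong suc len , λ where
      (here refl) _    → here refl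
      (there z∈ys) z≢y → there (keep z∈ys z≢y)

module _ {A B : Set} (f : A → B) where

  InjectiveOn : List A → Set
  InjectiveOn xs = ∀ {x y} → x ∈ xs → y ∈ xs → f x ≡ f y → x ≡ y

  MapsInto : List A → List B → Set
  MapsInto xs ys = ∀ {x} → x ∈ xs → f x ∈ ys

  injectiveOn⇒length≤ : ∀ {xs ys} → Unique xs → InjectiveOn xs → MapsInto xs ys →
    length xs ≤ length ys
  injectiveOn⇒length≤ {[]}     _            _   _    = z≤n
  injectiveOn⇒length≤ {x ∷ xs} {ys} (x∉xs ∷ u) inj into =
    let zs , len , keep = ∈-delete ys (into (here refl))
        into′ : MapsInto xs zs
        into′ y∈xs = keep (into (there y∈xs)) λ fy≡fx →
          All.lookup x∉xs y∈xs (sym (inj (there y∈xs) (here refl) fy≡fx))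
    in subst (suc (length xs) ≤_) (sym len)
         (s≤s (injectiveOn⇒length≤ u (λ p q → inj (there p) (there q)) into′))

  injectiveOn⇒length< : ∀ {xs ys y} → Unique xs → InjectiveOn xs → MapsInto xs ys →
    y ∈ ys → (∀ {x} → x ∈ xs → f x ≢ y) → length xs < length ys
  injectiveOn⇒length< {ys = ys} u inj into y∈ys missed =
    let zs , len , keep = ∈-delete ys y∈ys in
    subst (suc _ ≤_) (sym len)
      (s≤s (injectiveOn⇒length≤ u inj λ x∈xs → keep (into x∈xs) (missed x∈xs)))

module _ {A B : Set} where

  disjointUnion : List A → List B → List (A ⊎ B)
  disjointUnion xs ys = map inj₁ xs ++ map inj₂ ys

  length-disjointUnion : ∀ xs ys → length (disjointUnion xs ys) ≡ length xs + length ys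
  length-disjointUnion xs ys = trans (length-++ (map inj₁ xs))
    (cong₂ _+_ (length-map inj₁ xs) (length-map inj₂ ys))

  module _ {xs : List A} {ys : List B} where

    ∈-disjointUnion⁺ˡ : ∀ {x} → x ∈ xs → inj₁ x ∈ disjointUnion xs ys
    ∈-disjointUnion⁺ˡ x∈xs = ∈-++⁺ˡ (∈-map⁺ inj₁ x∈xs)

    ∈-disjointUnion⁺ʳ : ∀ {y} → y ∈ ys → inj₂ y ∈ disjointUnion xs ys
    ∈-disjointUnion⁺ʳ y∈ys = ∈-++⁺ʳ (map inj₁ xs) (∈-map⁺ inj₂ y∈ys)

    ∈-disjointUnion⁻ˡ : ∀ {x} → inj₁ x ∈ disjointUnion xs ys → x ∈ xs
    ∈-disjointUnion⁻ˡ p with ∈-++⁻ (map inj₁ xs) p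
    ... | inj₁ q with _ , x∈xs , refl ← ∈-map⁻ inj₁ q = x∈xs
    ... | inj₂ q with _ , _ , () ← ∈-map⁻ inj₂ q

    ∈-disjointUnion⁻ʳ : ∀ {y} → inj₂ y ∈ disjointUnion xs ys → y ∈ ys
    ∈-disjointUnion⁻ʳ p with ∈-++⁻ (map inj₁ xs) p
    ... | inj₁ q with _ , _ , () ← ∈-map⁻ inj₁ q
    ... | inj₂ q with _ , y∈ys , refl ← ∈-map⁻ inj₂ q = y∈ys

    disjointUnion-unique : Unique xs → Unique ys → Unique (disjointUnion xs ys)
    disjointUnion-unique uxs uys =
      Unique.++⁺ (Unique.map⁺ (λ { refl → refl }) uxs) (Unique.map⁺ (λ { refl → refl }) uys)
        λ (p , q) → let _ , _ , eq₁ = ∈-map⁻ inj₁ p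
                        _ , _ , eq₂ = ∈-map⁻ inj₂ q
                    in inj₁≢inj₂ (trans (sym eq₁) eq₂)
      where
      inj₁≢inj₂ : ∀ {a : A} {b : B} → inj₁ a ≢ inj₂ b
      inj₁≢inj₂ ()

concatMap-map≡cartesianProductWith : ∀ {A B C : Set} (f : A → B → C) xs ys →
  concatMap (λ a → map (f a) ys) xs ≡ cartesianProductWith f xs ys
concatMap-map≡cartesianProductWith f []       ys = refl
concatMap-map≡cartesianProductWith f (x ∷ xs) ys =
  cong (map (f x) ys ++_) (concatMap-map≡cartesianProductWith f xs ys)

Positive : Filling → Set
Positive = All (All (1 ≤_))

Bounded : ℕ → Filling → Set
Bounded m = All (All (_≤ m))

HasShape : List ℕ → Filling → Set
HasShape = Pointwise (λ r w → length w ≡ r)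

record IsTableau (λs : List ℕ) (m : ℕ) (T : Filling) : Set where
  field
    shape        : HasShape λs T
    positive     : Positive T
    bounded      : Bounded m T
    semistandard : IsSSYT T

module _ (m : ℕ) where

  private
    consSuc : ℕ → List ℕ → List ℕ
    consSuc a w = suc a ∷ w

    words≡ : ∀ r → words m (suc r) ≡ cartesianProductWith consSuc (upTo m) (words m r)
    words≡ r = concatMap-map≡cartesianProductWith consSuc (upTo m) (words m r)

    fillings≡ : ∀ r λs → fillings m (r ∷ λs) ≡ cartesianProductWith _∷_ (words m r) (fillings m λs)
    fillings≡ r λs = concatMap-map≡cartesianProductWith _∷_ (words m r) (fillings m λs)

  ∈-words⁻ : ∀ r {w} → w ∈ words m r → length w ≡ r × All (1 ≤_) w × All (_≤ m) w
  ∈-words⁻ zero    (here refl) = refl , [] , []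
  ∈-words⁻ (suc r) p
    with a , w , a∈ , w∈ , refl ← ∈-cartesianProductWith⁻ consSuc (upTo m) (words m r)
                                    (subst (_ ∈_) (words≡ r) p)
    with len , pos , bnd ← ∈-words⁻ r w∈
    = cong suc len , s≤s z≤n ∷ pos , ∈-upTo⁻ a∈ ∷ bnd

  ∈-words⁺ : ∀ {w} → All (1 ≤_) w → All (_≤ m) w → w ∈ words m (length w)
  ∈-words⁺ [] [] = here refl
  ∈-words⁺ {_ ∷ w} (s≤s z≤n ∷ pos) (a<m ∷ bnd) = subst (_ ∈_) (sym (words≡ (length w)))
    (∈-cartesianProductWith⁺ consSuc (∈-upTo⁺ a<m) (∈-words⁺ pos bnd))

  words-unique : ∀ r → Unique (words m r)
  words-unique zero    = [] ∷ []
  words-unique (suc r) = subst Unique (sym (words≡ r))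
    (Unique.cartesianProductWith⁺ consSuc
      (λ eq → let a≡b , w≡v = ∷-injective eq in suc-injective a≡b , w≡v)
      (Unique.upTo⁺ m) (words-unique r))

  ∈-fillings⁻ : ∀ λs {T} → T ∈ fillings m λs → HasShape λs T × Positive T × Bounded m T
  ∈-fillings⁻ []       (here refl) = [] , [] , []
  ∈-fillings⁻ (r ∷ λs) p
    with w , T , w∈ , T∈ , refl ← ∈-cartesianProductWith⁻ _∷_ (words m r) (fillings m λs)
                                    (subst (_ ∈_) (fillings≡ r λs) p)
    with len , pos , bnd ← ∈-words⁻ r w∈
    with shape , poss , bnds ← ∈-fillings⁻ λs T∈
    = len ∷ shape , pos ∷ poss , bnd ∷ bnds

  ∈-fillings⁺ : ∀ {λs T} → HasShape λs T → Positive T → Bounded m T → T ∈ fillings m λs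
  ∈-fillings⁺ [] [] [] = here refl
  ∈-fillings⁺ {r ∷ λs} (refl ∷ shape) (pos ∷ poss) (bnd ∷ bnds) =
    subst (_ ∈_) (sym (fillings≡ r λs))
      (∈-cartesianProductWith⁺ _∷_ (∈-words⁺ pos bnd) (∈-fillings⁺ shape poss bnds))

  fillings-unique : ∀ λs → Unique (fillings m λs)
  fillings-unique []       = [] ∷ []
  fillings-unique (r ∷ λs) = subst Unique (sym (fillings≡ r λs))
    (Unique.cartesianProductWith⁺ _∷_ ∷-injective (words-unique r) (fillings-unique λs))

tableaux : List ℕ → ℕ → List Filling
tableaux λs m = filter isSSYT? (fillings m λs)

module _ (λs : List ℕ) (m : ℕ) where

  ∈-tableaux⁻ : ∀ {T} → T ∈ tableaux λs m → IsTableau λs m T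
  ∈-tableaux⁻ p =
    let T∈ , ssyt = ∈-filter⁻ isSSYT? p
        shape , pos , bnd = ∈-fillings⁻ m λs T∈
    in record { shape = shape ; positive = pos ; bounded = bnd ; semistandard = ssyt }

  ∈-tableaux⁺ : ∀ {T} → IsTableau λs m T → T ∈ tableaux λs m
  ∈-tableaux⁺ t = ∈-filter⁺ isSSYT? (∈-fillings⁺ m shape positive bounded) semistandard
    where open IsTableau t

  tableaux-unique : Unique (tableaux λs m)
  tableaux-unique = Unique.filter⁺ isSSYT? (fillings-unique m λs)

module _ {f : ℕ → ℕ} (f-< : ∀ {a b} → a < b → f a < f b) where

  strictMono⇒mono : ∀ {a b} → a ≤ b → f a ≤ f b
  strictMono⇒mono a≤b with m≤n⇒m<n∨m≡n a≤b
  ... | inj₁ a<b  = <⇒≤ (f-< a<b)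
  ... | inj₂ refl = ≤-refl

  strictMono⇒injective : ∀ {a b} → f a ≡ f b → a ≡ b
  strictMono⇒injective {a} {b} eq with <-cmp a b
  ... | tri< a<b _ _ = contradiction eq (<⇒≢ (f-< a<b))
  ... | tri≈ _ a≡b _ = a≡b
  ... | tri> _ _ b<a = contradiction (sym eq) (<⇒≢ (f-< b<a))

  private
    rowWeak-map : ∀ {w} → RowWeak w → RowWeak (map f w)
    rowWeak-map row = Linked.map⁺ (Linked.map strictMono⇒mono row)

    colStrict-map : ∀ u v → ColStrict u v → ColStrict (map f u) (map f v)
    colStrict-map (a ∷ u) (b ∷ v) (a<b , c) = f-< a<b , colStrict-map u v c
    colStrict-map []      _       _         = tt
    colStrict-map (a ∷ u) []      _         = tt

  IsSSYT-map : ∀ T → IsSSYT T → IsSSYT (map (map f) T)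
  IsSSYT-map []           _               = tt
  IsSSYT-map (u ∷ [])     row             = rowWeak-map row
  IsSSYT-map (u ∷ v ∷ T) (row , col , rest) =
    rowWeak-map row , colStrict-map u v col , IsSSYT-map (v ∷ T) rest

All²-map : ∀ {P Q : ℕ → Set} {f : ℕ → ℕ} → (∀ {a} → P a → Q (f a)) →
  ∀ {T} → All (All P) T → All (All Q) (map (map f) T)
All²-map P⇒Q = All.map⁺ ∘ All.map (All.map⁺ ∘ All.map P⇒Q)

-- Convexity of m ↦ s_λ(1^m)

skip : ℕ → ℕ → ℕ
skip n a with a ≤? n
... | yes _ = a
... | no  _ = suc a

module _ (n : ℕ) where

  skip-< : ∀ {a b} → a < b → skip n a < skip n b
  skip-< {a} {b} a<b with a ≤? n | b ≤? n
  ... | yes _   | yes _   = a<b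
  ... | yes _   | no  _   = m<n⇒m<1+n a<b
  ... | no  a≰n | yes b≤n = contradiction (≤-trans (<⇒≤ a<b) b≤n) a≰n
  ... | no  _   | no  _   = s≤s a<b

  skip-increasing : ∀ a → a ≤ skip n a
  skip-increasing a with a ≤? n
  ... | yes _ = ≤-refl
  ... | no  _ = n≤1+n a

  skip≤suc : ∀ a → skip n a ≤ suc a
  skip≤suc a with a ≤? n
  ... | yes _ = n≤1+n a
  ... | no  _ = ≤-refl

  skip≢suc : ∀ a → skip n a ≢ suc n
  skip≢suc a with a ≤? n
  ... | yes a≤n = <⇒≢ (s≤s a≤n)
  ... | no  a≰n = λ eq → a≰n (≤-reflexive (suc-injective eq))

  skip≤suc⇒≤ : ∀ {a} → skip n a ≤ suc n → a ≤ n
  skip≤suc⇒≤ {a} le with a ≤? n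
  ... | yes a≤n = a≤n
  ... | no  _   = ≤-pred le

  lift : Filling → Filling
  lift = map (map (skip n))

  lift-shape : ∀ {λs T} → HasShape λs T → HasShape λs (lift T)
  lift-shape []                       = []
  lift-shape {T = w ∷ _} (len ∷ shape) = trans (length-map (skip n) w) len ∷ lift-shape shape

  lift-injective : ∀ {T U} → lift T ≡ lift U → T ≡ U
  lift-injective = map-injective (map-injective (strictMono⇒injective skip-<))

  lift-unbounded : ∀ {T} → ¬ Bounded n T → ¬ Bounded (suc n) (lift T)
  lift-unbounded ¬b b = ¬b (All.map (All.map skip≤suc⇒≤ ∘ All.map⁻) (All.map⁻ b))

Occurs : ℕ → Filling → Set
Occurs a = Any (a ∈_)

occurs⇒≤ : ∀ {a m T} → Bounded m T → Occurs a T → a ≤ m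
occurs⇒≤ (b ∷ _)  (here a∈w)  = All.lookup b a∈w
occurs⇒≤ (_ ∷ bs) (there occ) = occurs⇒≤ bs occ

lift-misses : ∀ n {T} → ¬ Occurs (suc n) (lift n T)
lift-misses n occ =
  let _ , _ , a∈w = find (Any.map⁻ occ)
      a , _ , eq = ∈-map⁻ (skip n) a∈w
  in skip≢suc n a (sym eq)

rebound-tableau : ∀ {λs k m T} → IsTableau λs k T → Bounded m T → IsTableau λs m T
rebound-tableau t b = record { shape = shape ; positive = positive ; bounded = b ; semistandard = semistandard }
  where open IsTableau t

weaken-tableau : ∀ {λs m T} → IsTableau λs m T → IsTableau λs (suc m) T
weaken-tableau t = rebound-tableau t (All.map (All.map m≤n⇒m≤1+n) (IsTableau.bounded t))

lift-tableau : ∀ {λs n T} → IsTableau λs (suc n) T → IsTableau λs (2 + n) (lift n T)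
lift-tableau {n = n} {T} t = record
  { shape        = lift-shape n shape
  ; positive     = All²-map (λ {a} 1≤a → ≤-trans 1≤a (skip-increasing n a)) positive
  ; bounded      = All²-map (λ {a} a≤ → ≤-trans (skip≤suc n a) (s≤s a≤)) bounded
  ; semistandard = IsSSYT-map (skip-< n) T semistandard
  }
  where open IsTableau t

module Relabelling (λs : List ℕ) (n : ℕ) where

  bounded? : (T : Filling) → Dec (Bounded n T)
  bounded? = all? (all? (_≤? n))

  relabel : (T : Filling) → Dec (Bounded n T) → Filling ⊎ Filling
  relabel T (yes _) = inj₂ T
  relabel T (no  _) = inj₁ (lift n T)

  φ : Filling ⊎ Filling → Filling ⊎ Filling
  φ (inj₁ T) = inj₁ T
  φ (inj₂ T) = relabel T (bounded? T)

  domain codomain : List (Filling ⊎ Filling)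
  domain   = disjointUnion (tableaux λs (suc n)) (tableaux λs (suc n))
  codomain = disjointUnion (tableaux λs (2 + n)) (tableaux λs n)

  relabel-into : ∀ {T} d → IsTableau λs (suc n) T → relabel T d ∈ codomain
  relabel-into (yes b) t = ∈-disjointUnion⁺ʳ (∈-tableaux⁺ λs n (rebound-tableau t b))
  relabel-into (no  _) t = ∈-disjointUnion⁺ˡ (∈-tableaux⁺ λs (2 + n) (lift-tableau t))

  relabel-injective : ∀ {T U} d e → relabel T d ≡ relabel U e → T ≡ U
  relabel-injective (yes _) (yes _) refl = refl
  relabel-injective (no  _) (no  _) eq   = lift-injective n (inj₁-injective eq)
  relabel-injective (yes _) (no  _) ()
  relabel-injective (no  _) (yes _) ()

  relabel-avoids : ∀ {T U} → IsTableau λs (suc n) T → ∀ d → inj₁ T ≢ relabel U d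
  relabel-avoids t (no ¬b) refl = lift-unbounded n ¬b (IsTableau.bounded t)

  φ-into : MapsInto φ domain codomain
  φ-into {inj₁ T} p = ∈-disjointUnion⁺ˡ
    (∈-tableaux⁺ λs (2 + n) (weaken-tableau (∈-tableaux⁻ λs (suc n) (∈-disjointUnion⁻ˡ p))))
  φ-into {inj₂ T} p = relabel-into (bounded? T) (∈-tableaux⁻ λs (suc n) (∈-disjointUnion⁻ʳ p))

  φ-injective : InjectiveOn φ domain
  φ-injective {inj₁ T} {inj₁ U} _ _ eq = eq
  φ-injective {inj₁ T} {inj₂ U} p _ eq =
    contradiction eq (relabel-avoids (∈-tableaux⁻ λs (suc n) (∈-disjointUnion⁻ˡ p)) (bounded? U))
  φ-injective {inj₂ T} {inj₁ U} _ q eq =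
    contradiction (sym eq) (relabel-avoids (∈-tableaux⁻ λs (suc n) (∈-disjointUnion⁻ˡ q)) (bounded? T))
  φ-injective {inj₂ T} {inj₂ U} _ _ eq = cong inj₂ (relabel-injective (bounded? T) (bounded? U) eq)

  length-domain : length domain ≡ schurOnes λs (suc n) + schurOnes λs (suc n)
  length-domain = length-disjointUnion (tableaux λs (suc n)) (tableaux λs (suc n))

  length-codomain : length codomain ≡ schurOnes λs (2 + n) + schurOnes λs n
  length-codomain = length-disjointUnion (tableaux λs (2 + n)) (tableaux λs n)

  domain-unique : Unique domain
  domain-unique = disjointUnion-unique (tableaux-unique λs (suc n)) (tableaux-unique λs (suc n))

  -- A tableau using both n+1 and n+2 is neither an (n+1)-tableau nor a relabelled one.
  φ-misses : ∀ {W} → Occurs (suc n) W → Occurs (2 + n) W → ∀ {x} → x ∈ domain → φ x ≢ inj₁ W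
  φ-misses _ top {inj₁ T} p refl =
    1+n≰n (occurs⇒≤ (IsTableau.bounded (∈-tableaux⁻ λs (suc n) (∈-disjointUnion⁻ˡ p))) top)
  φ-misses occ _ {inj₂ T} _ eq = misses (bounded? T) eq
    where
    misses : ∀ d → relabel T d ≢ inj₁ _
    misses (no _) refl = lift-misses n occ

schurOnes-convex : ∀ λs n →
  schurOnes λs (1 + n) + schurOnes λs (1 + n) ≤ schurOnes λs (2 + n) + schurOnes λs n
schurOnes-convex λs n = subst₂ _≤_ length-domain length-codomain
  (injectiveOn⇒length≤ φ domain-unique φ-injective φ-into)
  where open Relabelling λs n

schurOnes-strictlyConvex : ∀ λs n {W} → IsTableau λs (2 + n) W →
  Occurs (1 + n) W → Occurs (2 + n) W →
  1 + (schurOnes λs (1 + n) + schurOnes λs (1 + n)) ≤ schurOnes λs (2 + n) + schurOnes λs n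
schurOnes-strictlyConvex λs n W-tab occ top = subst₂ _≤_ (cong suc length-domain) length-codomain
  (injectiveOn⇒length< φ domain-unique φ-injective φ-into
    (∈-disjointUnion⁺ˡ (∈-tableaux⁺ λs (2 + n) W-tab)) (φ-misses occ top))
  where open Relabelling λs n

-- A tableau containing both n+1 and n+2

constantRows : ℕ → List ℕ → Filling
constantRows v []       = []
constantRows v (r ∷ rs) = replicate r v ∷ constantRows (suc v) rs

replicate-rowWeak : ∀ r v → RowWeak (replicate r v)
replicate-rowWeak zero          v = []
replicate-rowWeak (suc zero)    v = [-]
replicate-rowWeak (suc (suc r)) v = ≤-refl ∷ replicate-rowWeak (suc r) v

replicate-colStrict : ∀ r {v} w → All (v <_) w → ColStrict (replicate r v) w
replicate-colStrict zero    w       _          = tt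
replicate-colStrict (suc r) []      _          = tt
replicate-colStrict (suc r) (_ ∷ w) (v<b ∷ bs) = v<b , replicate-colStrict r w bs

constantRows-semistandard : ∀ v rs → IsSSYT (constantRows v rs)
constantRows-semistandard v []            = tt
constantRows-semistandard v (r ∷ [])      = replicate-rowWeak r v
constantRows-semistandard v (r ∷ r′ ∷ rs) =
  replicate-rowWeak r v ,
  replicate-colStrict r (replicate r′ (suc v)) (All.replicate⁺ r′ ≤-refl) ,
  constantRows-semistandard (suc v) (r′ ∷ rs)

constantRows-shape : ∀ v rs → HasShape rs (constantRows v rs)
constantRows-shape v []       = []
constantRows-shape v (r ∷ rs) = length-replicate r ∷ constantRows-shape (suc v) rs

constantRows-positive : ∀ {v} rs → 1 ≤ v → Positive (constantRows v rs)
constantRows-positive []       _   = []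
constantRows-positive (r ∷ rs) 1≤v = All.replicate⁺ r 1≤v ∷ constantRows-positive rs (m≤n⇒m≤1+n 1≤v)

constantRows-bounded : ∀ {v m} rs → v + length rs ≤ suc m → Bounded m (constantRows v rs)
constantRows-bounded          []       _  = []
constantRows-bounded {v} {m} (r ∷ rs) le =
  All.replicate⁺ r (≤-trans (m≤m+n v (length rs)) (≤-pred v+ℓ<))
    ∷ constantRows-bounded rs v+ℓ<
  where
  v+ℓ< : suc v + length rs ≤ suc m
  v+ℓ< = subst (_≤ suc m) (+-suc v (length rs)) le

constantRows-occurs : ∀ v {rs i} → All (1 ≤_) rs → i < length rs → Occurs (i + v) (constantRows v rs)
constantRows-occurs v {suc r ∷ _} {zero}  _         _         = here (here refl)
constantRows-occurs v {_ ∷ rs}    {suc i} (_ ∷ pos) (s≤s i<ℓ) =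
  there (subst (λ a → Occurs a (constantRows (suc v) rs)) (+-suc i v) (constantRows-occurs (suc v) pos i<ℓ))

twoTopEntries : ∀ {λs} n → All (1 ≤_) λs → 2 ≤ length λs → length λs ≤ 2 + n →
  ∃ λ W → IsTableau λs (2 + n) W × Occurs (1 + n) W × Occurs (2 + n) W
twoTopEntries {[]}     n _ () _
twoTopEntries {_ ∷ []} n _ (s≤s ()) _
twoTopEntries {λs@(_ ∷ _ ∷ rs)} n pos _ (s≤s (s≤s k≤n)) =
  W , tableau , subst (λ a → Occurs a W) k+1+d≡1+n (occurs (n≤1+n k))
              , subst (λ a → Occurs a W) (cong suc k+1+d≡1+n) (occurs ≤-refl)
  where
  k = length rs
  d = proj₁ (m≤n⇒∃[o]m+o≡n k≤n)

  k+d≡n : k + d ≡ n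
  k+d≡n = proj₂ (m≤n⇒∃[o]m+o≡n k≤n)

  k+1+d≡1+n : k + suc d ≡ suc n
  k+1+d≡1+n = trans (+-suc k d) (cong suc k+d≡n)

  W = constantRows (suc d) λs

  tableau : IsTableau λs (2 + n) W
  tableau = record
    { shape        = constantRows-shape (suc d) λs
    ; positive     = constantRows-positive λs (s≤s z≤n)
    ; bounded      = constantRows-bounded λs (≤-reflexive (begin
        suc d + (2 + k)   ≡⟨ cong suc (+-comm d (2 + k)) ⟩
        suc (2 + (k + d)) ≡⟨ cong (3 +_) k+d≡n ⟩
        3 + n             ∎))
    ; semistandard = constantRows-semistandard (suc d) λs
    }
    where open ≡-Reasoning

  occurs : ∀ {i} → i ≤ suc k → Occurs (i + suc d) W
  occurs i≤ = constantRows-occurs (suc d) pos (s≤s i≤)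

-- From convexity to monotonicity of m ↦ s(m) / m

ratio-step : ∀ n {a b c} e → (1 + n) * a ≤ n * b → e + (b + b) ≤ c + a →
  (2 + n) * b + (1 + n) * e ≤ (1 + n) * c
ratio-step n {a} {b} {c} e ratio convex = +-cancelʳ-≤ (n * b) _ _ (begin
  (2 + n) * b + (1 + n) * e + n * b ≡⟨ rearrange n b e ⟩
  (1 + n) * (e + (b + b))           ≤⟨ *-monoʳ-≤ (1 + n) convex ⟩
  (1 + n) * (c + a)                 ≡⟨ *-distribˡ-+ (1 + n) c a ⟩
  (1 + n) * c + (1 + n) * a         ≤⟨ +-monoʳ-≤ ((1 + n) * c) ratio ⟩
  (1 + n) * c + n * b               ∎)
  where
  open ≤-Reasoning
  rearrange : ∀ n b e → (2 + n) * b + (1 + n) * e + n * b ≡ (1 + n) * (e + (b + b))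
  rearrange = solve-∀

convex⇒ratio-mono : ∀ {f : ℕ → ℕ} → f 0 ≡ 0 →
  (∀ n → f (1 + n) + f (1 + n) ≤ f (2 + n) + f n) →
  ∀ n → (1 + n) * f n ≤ n * f (1 + n)
convex⇒ratio-mono f0≡0 _      zero    = ≤-reflexive (trans (+-identityʳ _) f0≡0)
convex⇒ratio-mono {f} f0≡0 convex (suc n) =
  subst (_≤ (1 + n) * f (2 + n)) (trans (cong ((2 + n) * f (1 + n) +_) (*-zeroʳ (1 + n))) (+-identityʳ _))
    (ratio-step n 0 (convex⇒ratio-mono {f} f0≡0 convex n) (convex n))

lemma4p1 : (λs : List ℕ) → IsPartition λs → 1 ≤ ℓ λs →
    ((n : ℕ) → (2 + n) * schurOnes λs (1 + n) ≤ (1 + n) * schurOnes λs (2 + n))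
    × ((n : ℕ) → 2 ≤ ℓ λs → ℓ λs ≤ 1 + n →
       (2 + n) * schurOnes λs (1 + n) + (1 + n) ≤ (1 + n) * schurOnes λs (2 + n))
lemma4p1 []        _               ()
lemma4p1 (zero ∷ _) (() ∷ _ , _) _
lemma4p1 λs@(suc _ ∷ _) (positive , _) _ = (λ n → ratio (suc n)) , strict
  where
  ratio : ∀ n → (1 + n) * schurOnes λs n ≤ n * schurOnes λs (1 + n)
  -- s(0) = 0 by computation: the nonempty first row has no word over ∅.
  ratio = convex⇒ratio-mono refl (schurOnes-convex λs)

  strict : ∀ n → 2 ≤ ℓ λs → ℓ λs ≤ 1 + n →
    (2 + n) * schurOnes λs (1 + n) + (1 + n) ≤ (1 + n) * schurOnes λs (2 + n)
  strict n 2≤ℓ ℓ≤1+n =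
    let _ , W-tableau , occ , top = twoTopEntries n positive 2≤ℓ (m≤n⇒m≤1+n ℓ≤1+n)
    in subst (_≤ (1 + n) * schurOnes λs (2 + n)) (cong ((2 + n) * schurOnes λs (1 + n) +_) (*-identityʳ (1 + n)))
         (ratio-step n 1 (ratio n) (schurOnes-strictlyConvex λs n W-tableau occ top))
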